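{- For every tree $T$ (with at least two vertices), $Z(T) \le sdim(T)$.
   Context: All graphs are finite, simple, undirected and connected with at least two vertices. Zero forcing: color each vertex of $G$ black or white, with $S$ the initial set of black vertices. The color-change rule turns a white vertex $u_2$ black if $u_2$ is the only white neighbor of some black vertex $u_1$. $S$ is a zero forcing set if repeated application of the rule eventually turns every vertex black; $Z(G)$ is the minimum cardinality of a zero forcing set of $G$. A vertex $x$ strongly resolves a pair $u,v$ if $u$ lies on some shortest $x$–$v$ path or $v$ lies on some shortest $x$–$u$ path. A set $W \subseteq V(G)$ is a strong resolving set if every pair of distinct vertices of $G$ is strongly resolved by some vertex of $W$; $sdim(G)$ is the minimum cardinality of a strong resolving set of $G$. -}

module Defs where

open import Data.Nat using (ℕ; zero; suc; _+_; _≤_; _≥_)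
open import Data.Fin using (Fin)
open import Data.Fin.Subset using (Subset; _∈_; ∣_∣)
open import Data.List using (List; []; _∷_; length)
open import Data.List.Relation.Unary.Unique.Propositional using (Unique)
open import Data.Product using (Σ; ∃; ∃-syntax; _×_; _,_)
open import Data.Sum using (_⊎_)
open import Relation.Nullary using (¬_; Dec)
open import Relation.Binary.PropositionalEquality using (_≡_)

record Graph (n : ℕ) : Set₁ where
  field
    Adj     : Fin n → Fin n → Set
    irrefl  : ∀ {u} → ¬ Adj u u
    sym     : ∀ {u v} → Adj u v → Adj v u
    adj?    : ∀ u v → Dec (Adj u v)
open Graph public

module _ {n : ℕ} (G : Graph n) where

  data Walk : Fin n → Fin n → ℕ → Set where
    here : ∀ {u} → Walk u u zero
    step : ∀ {u w v k} → Adj G u w → Walk w v k → Walk u v (suc k)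

  Connected : Set
  Connected = ∀ u v → ∃[ k ] Walk u v k

  data IsPathList : List (Fin n) → Set where
    one  : ∀ {u} → IsPathList (u ∷ [])
    cons : ∀ {u w vs} → Adj G u w → IsPathList (w ∷ vs) → IsPathList (u ∷ w ∷ vs)

  data LastAdj (u : Fin n) : List (Fin n) → Set where
    last : ∀ {v} → Adj G v u → LastAdj u (v ∷ [])
    more : ∀ {v w vs} → LastAdj u (w ∷ vs) → LastAdj u (v ∷ w ∷ vs)

  Cycle : List (Fin n) → Set
  Cycle vs = (length vs ≥ 3) × Unique vs × IsPathList vs ×
             Σ (Fin n) λ u → Σ (List (Fin n)) λ ws → (vs ≡ u ∷ ws) × LastAdj u ws

  Acyclic : Set
  Acyclic = ∀ vs → ¬ Cycle vs

  -- A tree: connected, acyclic (at least two vertices is imposed on n).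
  IsTree : Set
  IsTree = Connected × Acyclic

  -- u lies on some shortest x–v path: there is an x–v walk through u
  -- whose length is at most that of every x–v walk.
  OnShortest : Fin n → Fin n → Fin n → Set
  OnShortest x u v =
    Σ ℕ λ a → Σ ℕ λ b → Walk x u a × Walk u v b ×
      (∀ m → Walk x v m → a + b ≤ m)

  StronglyResolves : Fin n → Fin n → Fin n → Set
  StronglyResolves x u v = OnShortest x u v ⊎ OnShortest x v u

  IsStrongResolvingSet : Subset n → Set
  IsStrongResolvingSet W =
    ∀ u v → ¬ u ≡ v → ∃[ x ] (x ∈ W × StronglyResolves x u v)

  -- Vertices eventually coloured black from initial set S under the
  -- colour-change rule (least closed set; equals the final colouring).
  data Black (S : Subset n) : Fin n → Set where
    init  : ∀ {v} → v ∈ S → Black S v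
    force : ∀ {u v} → Black S u → Adj G u v →
            (∀ w → Adj G u w → ¬ w ≡ v → Black S w) → Black S v

  IsZeroForcingSet : Subset n → Set
  IsZeroForcingSet S = ∀ v → Black S v

-- Take S = W. A leaf never lies strictly inside a shortest path (both of its
-- path neighbours would be its unique neighbour, so the detour through it
-- could be cut out); hence two distinct leaves are strongly resolved only
-- by themselves, and W contains all leaves except at most one, say t.
-- Orient the tree towards t. Every vertex z ≠ t is black: either z ∈ W, or
-- z is not a leaf and has a child w; by induction on the branch below z,
-- w and all children of w are black, so w forces z. Finally t is forced by
-- any of its neighbours.
module Submission where

open import Defs
open import Data.Nat using (ℕ; _≤_; _≥_)
open import Data.Fin.Subset using (Subset; ∣_∣)
open import Data.Product using (∃-syntax; _×_)

open import Data.Nat using (zero; suc; _+_; _<_; z≤n; s≤s)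
open import Data.Nat.Properties
  using (≤-refl; ≤-trans; ≤⇒≯; 1+n≰n; m<n⇒m<1+n; n≤1+n; +-suc; +-monoʳ-≤; +-identityʳ; m≤n+m)
open import Data.Fin using (Fin; _≟_) renaming (zero to fzero; suc to fsuc)
open import Data.Fin.Properties using (any?; all?; injective⇒≤; punchInᵢ≢i)
open import Data.Fin.Subset using (_∉_)
open import Data.Fin.Subset.Properties using (_∈?_)
open import Data.List using (List; []; _∷_; length; lookup)
open import Data.List.Membership.Propositional using () renaming (_∈_ to _∈ₗ_)
open import Data.List.Membership.Propositional.Properties using (∈-lookup)
open import Data.List.Relation.Unary.All as All using (All; []; _∷_)
open import Data.List.Relation.Unary.All.Properties using (¬Any⇒All¬)
open import Data.List.Relation.Unary.Any using (here; there)
open import Data.List.Relation.Unary.Unique.Propositional using (Unique; []; _∷_)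
open import Data.List.Relation.Unary.Unique.Propositional.Properties using (Unique[x∷xs]⇒x∉xs)
open import Data.Product using (Σ; _,_; proj₁; proj₂)
open import Data.Sum using (inj₁; inj₂)
open import Relation.Nullary using (¬_; Dec; yes; no; contradiction)
open import Relation.Nullary.Decidable using (_×-dec_; _→-dec_; ¬?; decidable-stable)
open import Relation.Binary.PropositionalEquality using (_≡_; _≢_; refl; cong; subst; trans; ≢-sym)
import Relation.Binary.PropositionalEquality as ≡

module _ {a} {A : Set a} where

  lookup-injective : ∀ {xs : List A} → Unique xs → ∀ {i j} → lookup xs i ≡ lookup xs j → i ≡ j
  lookup-injective (_  ∷ _) {fzero}  {fzero}  _ = refl
  lookup-injective (x∉ ∷ _) {fzero}  {fsuc j} e = contradiction e (All.lookup x∉ (∈-lookup j))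
  lookup-injective (x∉ ∷ _) {fsuc i} {fzero}  e = contradiction (≡.sym e) (All.lookup x∉ (∈-lookup i))
  lookup-injective (_  ∷ u) {fsuc i} {fsuc j} e = cong fsuc (lookup-injective u e)

Unique⇒length≤ : ∀ {n} {xs : List (Fin n)} → Unique xs → length xs ≤ n
Unique⇒length≤ u = injective⇒≤ (lookup-injective u)

module _ {n : ℕ} (G : Graph n) where

  open import Data.List.Membership.DecPropositional (_≟_ {n}) using () renaming (_∈?_ to _∈ₗ?_)

  Leaf : Fin n → Set
  Leaf x = ∀ y y′ → Adj G x y → Adj G x y′ → y ≡ y′

  leaf? : ∀ x → Dec (Leaf x)
  leaf? x = all? λ y → all? λ y′ → adj? G x y →-dec (adj? G x y′ →-dec (y ≟ y′))

  SimplePath : List (Fin n) → Set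
  SimplePath xs = Unique xs × IsPathList G xs

  unsnoc : ∀ {x y k} → Walk G x y (suc k) → ∃[ q ] (Walk G x q k × Adj G q y)
  unsnoc (step xy here)         = _ , here , xy
  unsnoc (step xw (step wq p)) with unsnoc (step wq p)
  ... | q , p′ , qy = q , step xw p′ , qy

  _++ʷ_ : ∀ {x y z k l} → Walk G x y k → Walk G y z l → Walk G x z (k + l)
  here       ++ʷ q = q
  step xw p ++ʷ q = step xw (p ++ʷ q)

  visits : ∀ {u v k} → Walk G u v k → List (Fin n)
  visits here               = []
  visits (step {w = w} _ p) = w ∷ visits p

  visits-path : ∀ {u v k} (p : Walk G u v k) → IsPathList G (u ∷ visits p)
  visits-path here        = one
  visits-path (step uw p) = cons uw (visits-path p)

  end∈visits : ∀ {u v k} (p : Walk G u v k) → v ∈ₗ u ∷ visits p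
  end∈visits here       = here refl
  end∈visits (step _ p) = there (end∈visits p)

  suffix-from : ∀ {u v x k} (p : Walk G u v k) → x ∈ₗ u ∷ visits p → Unique (u ∷ visits p) →
                ∃[ m ] Σ (Walk G x v m) λ q → Unique (x ∷ visits q)
  suffix-from p          (here refl) uniq       = _ , p , uniq
  suffix-from (step _ p) (there x∈)  (_ ∷ uniq) = suffix-from p x∈ uniq

  walk⇒simple : ∀ {u v k} → Walk G u v k → ∃[ m ] Σ (Walk G u v m) λ p → Unique (u ∷ visits p)
  walk⇒simple here = _ , here , [] ∷ []
  walk⇒simple {u} (step uw p) with walk⇒simple p
  ... | m , q , uniq with u ∈ₗ? visits (step uw q)
  ...   | yes u∈ = suffix-from q u∈ uniq
  ...   | no u∉  = suc m , step uw q , ¬Any⇒All¬ _ u∉ ∷ uniq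

  takeTo : ∀ {w x} xs → w ∈ₗ x ∷ xs → List (Fin n)
  takeTo _        (here _)  = []
  takeTo (y ∷ ys) (there p) = y ∷ takeTo ys p

  takeTo-All : ∀ {P : Fin n → Set} {w x xs} → All P (x ∷ xs) → (p : w ∈ₗ x ∷ xs) → All P (x ∷ takeTo xs p)
  takeTo-All (px ∷ _)                  (here _)  = px ∷ []
  takeTo-All {xs = _ ∷ _} (px ∷ pxs) (there p) = px ∷ takeTo-All pxs p

  takeTo-Unique : ∀ {w x xs} → Unique (x ∷ xs) → (p : w ∈ₗ x ∷ xs) → Unique (x ∷ takeTo xs p)
  takeTo-Unique _                         (here _)  = [] ∷ []
  takeTo-Unique {xs = _ ∷ _} (x∉ ∷ uniq) (there p) = takeTo-All x∉ p ∷ takeTo-Unique uniq p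

  takeTo-path : ∀ {w x xs} → IsPathList G (x ∷ xs) → (p : w ∈ₗ x ∷ xs) → IsPathList G (x ∷ takeTo xs p)
  takeTo-path _                          (here _)  = one
  takeTo-path {xs = _ ∷ _} (cons xy path) (there p) = cons xy (takeTo-path path p)

  takeTo-LastAdj : ∀ {u w x xs} → Adj G w u → (p : w ∈ₗ x ∷ xs) → LastAdj G u (x ∷ takeTo xs p)
  takeTo-LastAdj wu                (here refl) = last wu
  takeTo-LastAdj {xs = _ ∷ _} wu (there p)   = more (takeTo-LastAdj wu p)

  chord⇒cycle : ∀ {u v w rest} → SimplePath (u ∷ v ∷ rest) → w ∈ₗ rest → Adj G u w → ∃[ vs ] Cycle G vs
  chord⇒cycle {u} {v} {rest = _ ∷ _} (u∉ ∷ uniq , cons uv path) w∈ uw =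
    u ∷ v ∷ _ ∷ takeTo _ w∈ ,
    s≤s (s≤s (s≤s z≤n)) ,
    takeTo-All u∉ (there w∈) ∷ takeTo-Unique uniq (there w∈) ,
    cons uv (takeTo-path path (there w∈)) ,
    u , _ , refl , takeTo-LastAdj (sym G uw) (there w∈)

  extend : Acyclic G → ∀ {u v w rest} → SimplePath (u ∷ v ∷ rest) → Adj G u w → w ≢ v →
           SimplePath (w ∷ u ∷ v ∷ rest)
  extend acyclic {u} {w = w} {rest} sp@(uniq , path) uw w≢v =
    (w≢u ∷ w≢v ∷ All.tabulate w∉rest) ∷ uniq , cons (sym G uw) path
    where
    w≢u : w ≢ u
    w≢u refl = irrefl G uw
    w∉rest : ∀ {x} → x ∈ₗ rest → w ≢ x
    w∉rest x∈ refl = let vs , cycle = chord⇒cycle sp x∈ uw in acyclic vs cycle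

  leaf-not-inner : ∀ {x l v} → Leaf l → x ≢ l → l ≢ v → ¬ OnShortest G x l v
  leaf-not-inner _ x≢l _   (zero  , _     , here , _)      = x≢l refl
  leaf-not-inner _ _   l≢v (suc a , zero  , _ , here , _)  = l≢v refl
  leaf-not-inner leaf _ _  (suc a , suc b , xl , step {w = p} lp pv , shortest) with unsnoc xl
  ... | q , xq , ql with leaf q p (sym G ql) lp
  ... | refl = 1+n≰n (≤-trans (s≤s (+-monoʳ-≤ a (n≤1+n b))) (shortest (a + b) (xq ++ʷ pv)))

  connected⇒neighbour : Connected G → ∀ {t s} → t ≢ s → ∃[ p ] Adj G t p
  connected⇒neighbour connected {t} {s} t≢s with connected t s
  ... | _ , here      = contradiction refl t≢s
  ... | _ , step tp _ = _ , tp

module _ {n : ℕ} {G : Graph n} (W : Subset n) where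

  UncoveredLeavesIn : List (Fin n) → Set
  UncoveredLeavesIn xs = ∀ x → x ∉ W → Leaf G x → x ∈ₗ xs

  uncovered-leaves-equal : IsStrongResolvingSet G W →
    ∀ {x y} → x ∉ W → Leaf G x → y ∉ W → Leaf G y → x ≡ y
  uncovered-leaves-equal resolving {x} {y} x∉W x-leaf y∉W y-leaf with x ≟ y
  ... | yes x≡y = x≡y
  ... | no x≢y with resolving x y x≢y
  ...   | z , z∈W , inj₁ x-inner = contradiction x-inner (leaf-not-inner G x-leaf (λ { refl → x∉W z∈W }) x≢y)
  ...   | z , z∈W , inj₂ y-inner = contradiction y-inner (leaf-not-inner G y-leaf (λ { refl → y∉W z∈W }) (≢-sym x≢y))

  at-most-one-uncovered-leaf : IsStrongResolvingSet G W → Fin n →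
    ∃[ t ] (∀ x → x ∉ W → Leaf G x → x ≡ t)
  at-most-one-uncovered-leaf resolving t₀ with any? (λ x → ¬? (x ∈? W) ×-dec leaf? G x)
  ... | yes (t , t∉W , t-leaf) =
    t , λ x x∉W x-leaf → uncovered-leaves-equal resolving x∉W x-leaf t∉W t-leaf
  ... | no none = t₀ , λ x x∉W x-leaf → contradiction (x , x∉W , x-leaf) none

  black-by-neighbour : ∀ {t p} → (∀ z → z ≢ t → Black G W z) → Adj G t p → Black G W t
  black-by-neighbour {t} {p} black tp = force (black p p≢t) (sym G tp) (λ y _ y≢t → black y y≢t)
    where
    p≢t : p ≢ t
    p≢t refl = irrefl G tp

  module _ (acyclic : Acyclic G) where

    -- k is fuel: a simple path has at most n vertices (Unique⇒length≤).
    black-branch : ∀ k {u v rest} → SimplePath G (u ∷ v ∷ rest) → n < length (u ∷ v ∷ rest) + k →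
                   UncoveredLeavesIn (v ∷ rest) → Black G W u
    black-branch zero (uniq , _) fuel _ =
      contradiction (subst (n <_) (+-identityʳ _) fuel) (≤⇒≯ (Unique⇒length≤ uniq))
    black-branch (suc k) {u} {v} {rest} sp fuel covered with u ∈? W
    ... | yes u∈W = init u∈W
    ... | no u∉W with any? (λ w → adj? G u w ×-dec ¬? (w ≟ v))
    ...   | no only-v = contradiction (covered u u∉W u-leaf) (Unique[x∷xs]⇒x∉xs (proj₁ sp))
      where
      toward-v : ∀ w → Adj G u w → w ≡ v
      toward-v w uw = decidable-stable (w ≟ v) λ w≢v → only-v (w , uw , w≢v)
      u-leaf : Leaf G u
      u-leaf y y′ uy uy′ = trans (toward-v y uy) (≡.sym (toward-v y′ uy′))
    ...   | yes (w , uw , w≢v) = force (black-branch k sp′ fuel′ covered′) (sym G uw) children-black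
      where
      sp′ : SimplePath G (w ∷ u ∷ v ∷ rest)
      sp′ = extend G acyclic sp uw w≢v
      fuel′ : n < length (w ∷ u ∷ v ∷ rest) + k
      fuel′ = subst (n <_) (+-suc _ k) fuel
      covered′ : UncoveredLeavesIn (u ∷ v ∷ rest)
      covered′ x x∉W x-leaf = there (covered x x∉W x-leaf)
      children-black : ∀ x → Adj G w x → x ≢ u → Black G W x
      children-black x wx x≢u =
        black-branch k (extend G acyclic sp′ wx x≢u) (m<n⇒m<1+n fuel′)
          (λ y y∉W y-leaf → there (covered′ y y∉W y-leaf))

    black-below : ∀ {u v rest} → SimplePath G (u ∷ v ∷ rest) → UncoveredLeavesIn (v ∷ rest) → Black G W u
    black-below {u} {v} {rest} sp = black-branch (suc n) sp (m≤n+m (suc n) (length (u ∷ v ∷ rest)))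

    black-except : Connected G → ∀ {t} → (∀ x → x ∉ W → Leaf G x → x ≡ t) → ∀ z → z ≢ t → Black G W z
    black-except connected {t} only-t z z≢t with walk⇒simple G (proj₂ (connected z t))
    ... | _ , here , _          = contradiction refl z≢t
    ... | _ , step zw p , uniq = black-below (uniq , visits-path G (step zw p)) covered
      where
      covered : UncoveredLeavesIn (visits G (step zw p))
      covered x x∉W x-leaf = subst (_∈ₗ _) (≡.sym (only-t x x∉W x-leaf)) (end∈visits G p)

theorem2p4 : (n : ℕ) → n ≥ 2 → (T : Graph n) → IsTree T →
    (W : Subset n) → IsStrongResolvingSet T W →
    ∃[ S ] (IsZeroForcingSet T S × ∣ S ∣ ≤ ∣ W ∣)
theorem2p4 (suc (suc m)) (s≤s (s≤s _)) T (connected , acyclic) W resolving = W , zero-forcing , ≤-refl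
  where
  t = proj₁ (at-most-one-uncovered-leaf W resolving fzero)
  only-t = proj₂ (at-most-one-uncovered-leaf W resolving fzero)
  black-but-t : ∀ z → z ≢ t → Black T W z
  black-but-t = black-except W acyclic connected only-t
  zero-forcing : IsZeroForcingSet T W
  zero-forcing z with z ≟ t
  ... | no z≢t  = black-but-t z z≢t
  ... | yes refl =
    black-by-neighbour W black-but-t
      (proj₂ (connected⇒neighbour T connected (≢-sym (punchInᵢ≢i t fzero))))
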